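{- If $G$ is an $(n-3)$-regular graph of order $n\geq 6$, then $\gamma_{tR}(G)=4$, and moreover $G$ is stable, i.e. $\gamma_{tR}(G+e)=\gamma_{tR}(G)$ for every $e\in E(\overline{G})$.
   Context: All graphs are finite and simple. For a graph $G$ with no isolated vertices, a total Roman dominating function is a map $f:V(G)\to\{0,1,2\}$ such that every vertex with $f(v)=0$ is adjacent to a vertex $u$ with $f(u)=2$, and the subgraph induced by $\{v:f(v)>0\}$ has no isolated vertices; $\gamma_{tR}(G)$ is the minimum of $\sum_v f(v)$ over such $f$. -}

module Defs where

open import Data.Bool using (Bool; true; false; if_then_else_; _∨_; _∧_)
open import Data.Nat using (ℕ; zero; suc; _<_; _≤_; _∸_)
open import Data.Fin using (Fin; toℕ; _≟_)
open import Data.List using (List; map; allFin)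
open import Data.Nat.ListAction using (sum)
open import Data.Empty using (⊥)
open import Data.Product using (_×_; ∃)
open import Relation.Nullary.Decidable using (⌊_⌋)
open import Relation.Binary.PropositionalEquality using (_≡_)

Graph : ℕ → Set
Graph n = Fin n → Fin n → Bool

IsSimple : ∀ {n} → Graph n → Set
IsSimple {n} G = (∀ (i : Fin n) → G i i ≡ false) × (∀ (i j : Fin n) → G i j ≡ G j i)

degree : ∀ {n} → Graph n → Fin n → ℕ
degree {n} G i = sum (map (λ j → if G i j then 1 else 0) (allFin n))

IsRegular : ∀ {n} → Graph n → ℕ → Set
IsRegular {n} G r = ∀ (v : Fin n) → degree G v ≡ r

-- G + uv : add the edge uv (intended for a non-edge uv with u ≠ v)
addEdge : ∀ {n} → Graph n → Fin n → Fin n → Graph n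
addEdge G u v i j = G i j ∨ (⌊ i ≟ u ⌋ ∧ ⌊ j ≟ v ⌋) ∨ (⌊ i ≟ v ⌋ ∧ ⌊ j ≟ u ⌋)

IsNonEdge : ∀ {n} → Graph n → Fin n → Fin n → Set
IsNonEdge G u v = (u ≡ v → ⊥) × (G u v ≡ false)

val : ∀ {n} → (Fin n → Fin 3) → Fin n → ℕ
val f v = toℕ (f v)

weight : ∀ {n} → (Fin n → Fin 3) → ℕ
weight {n} f = sum (map (val f) (allFin n))

IsTRDF : ∀ {n} → Graph n → (Fin n → Fin 3) → Set
IsTRDF {n} G f =
  (∀ (v : Fin n) → val f v ≡ 0 → ∃ λ (u : Fin n) → (G v u ≡ true) × (val f u ≡ 2)) ×
  (∀ (v : Fin n) → 0 < val f v → ∃ λ (u : Fin n) → (G v u ≡ true) × (0 < val f u))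

IsTRDomNumber : ∀ {n} → Graph n → ℕ → Set
IsTRDomNumber {n} G k =
  (∃ λ (f : Fin n → Fin 3) → IsTRDF G f × (weight f ≡ k)) ×
  (∀ (f : Fin n → Fin 3) → IsTRDF G f → k ≤ weight f)

-- In an (n − 3)-regular graph every vertex v has exactly two non-neighbours besides itself.
-- Hence no vertex is universal, even after one edge is added, and then every total Roman
-- dominating function has weight at least 4: a vertex labelled 2 has a non-neighbour, which
-- either needs a second 2 or forces a third positive vertex.  Conversely, for a vertex u with
-- non-neighbours a and b, a neighbour w of u adjacent to both a and b exists once n ≥ 6, and
-- labelling u and w by 2 is a total Roman dominating function of weight 4 in G and in every
-- graph containing G.

module Submission where

open import Defs
open import Algebra.Properties.CommutativeSemigroup using (x∙yz≈y∙xz)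
import Algebra.Properties.CommutativeMonoid.Sum as MonoidSum
open import Data.Bool using (Bool; true; false; if_then_else_; _∨_; _∧_; not)
open import Data.Bool.Properties using (∧-comm; ∨-comm; not-injective)
open import Data.Empty using (⊥-elim)
open import Data.Fin using (Fin; zero; suc; fromℕ<; #_; _≟_)
open import Data.Fin.Properties using (any?)
open import Data.List using (List; []; _∷_; length; map; allFin; tabulate)
open import Data.List.Properties using (map-tabulate; map-cong-local)
open import Data.List.Membership.Propositional using (_∉_)
open import Data.List.Relation.Unary.All as All using (All; []; _∷_)
open import Data.List.Relation.Unary.Any using (here; there)
open import Data.List.Relation.Unary.Unique.Propositional using (Unique)
open import Data.List.Relation.Unary.AllPairs using ([]; _∷_)
open import Data.Nat using (ℕ; zero; suc; _+_; _∸_; _≤_; _<_; z≤n; s≤s; s≤s⁻¹)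
open import Data.Nat.ListAction using (sum)
open import Data.Nat.Properties as ℕ
  using (≤-trans; ≤-reflexive; +-mono-≤; +-monoˡ-≤; +-monoʳ-≤; +-identityʳ; +-cancelˡ-≡;
         m≤m+n; m∸n+n≡m; ∸-monoˡ-≤; n≢0⇒n>0; <-irrefl; +-commutativeSemigroup;
         +-0-commutativeMonoid; module ≤-Reasoning)
open import Data.Product as Prod using (_×_; _,_; ∃)
open import Data.Sum using (_⊎_; inj₁; inj₂; [_,_]′)
open import Data.Vec.Functional using (updateAt)
open import Data.Vec.Functional.Properties using (updateAt-updates; updateAt-minimal; map-updateAt)
open import Function using (_∘_; const; id)
open import Relation.Nullary using (¬_; Dec; yes; no; contradiction)
open import Relation.Nullary.Decidable using (⌊_⌋; isYes≗does; dec-false; _×-dec_; _⊎-dec_)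
open import Relation.Binary.PropositionalEquality
  using (_≡_; _≢_; refl; sym; trans; cong; cong₂; subst; ≢-sym; module ≡-Reasoning)

open MonoidSum +-0-commutativeMonoid using (sum-cong-≗; sum-replicate-zero; ∑-distrib-+)
  renaming (sum to ∑)

private
  variable
    n : ℕ

sum-tabulate : (h : Fin n → ℕ) → sum (tabulate h) ≡ ∑ h
sum-tabulate {zero} h = refl
sum-tabulate {suc n} h = cong (h zero +_) (sum-tabulate (h ∘ suc))

sum-map-allFin : (h : Fin n → ℕ) → sum (map h (allFin n)) ≡ ∑ h
sum-map-allFin h = trans (cong sum (map-tabulate (λ i → i) h)) (sum-tabulate h)

∑-mono-≤ : {h g : Fin n → ℕ} → (∀ i → h i ≤ g i) → ∑ h ≤ ∑ g
∑-mono-≤ {zero} h≤g = z≤n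
∑-mono-≤ {suc n} h≤g = +-mono-≤ (h≤g zero) (∑-mono-≤ (h≤g ∘ suc))

∑-1 : ∑ {n} (const 1) ≡ n
∑-1 {zero} = refl
∑-1 {suc n} = cong suc ∑-1

∑-updateAt-0 : (h : Fin n → ℕ) (i : Fin n) → ∑ h ≡ h i + ∑ (updateAt h i (const 0))
∑-updateAt-0 {suc n} h zero = refl
∑-updateAt-0 {suc n} h (suc i) =
  trans (cong (h zero +_) (∑-updateAt-0 (h ∘ suc) i))
        (x∙yz≈y∙xz +-commutativeSemigroup (h zero) (h (suc i)) (∑ (updateAt (h ∘ suc) i (const 0))))

∑-pair : (h : Fin n → ℕ) {u w : Fin n} → u ≢ w → (∀ v → v ≢ u → v ≢ w → h v ≡ 0) →
         ∑ h ≡ h u + h w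
∑-pair {n} h {u} {w} u≢w vanishes = begin
  ∑ h                   ≡⟨ ∑-updateAt-0 h u ⟩
  h u + ∑ h₁            ≡⟨ cong (h u +_) (∑-updateAt-0 h₁ w) ⟩
  h u + (h₁ w + ∑ h₂)   ≡⟨ cong₂ (λ x s → h u + (x + s)) (updateAt-minimal w u h (≢-sym u≢w)) ∑h₂≡0 ⟩
  h u + (h w + 0)       ≡⟨ cong (h u +_) (+-identityʳ (h w)) ⟩
  h u + h w             ∎
  where
  open ≡-Reasoning
  h₁ h₂ : Fin n → ℕ
  h₁ = updateAt h u (const 0)
  h₂ = updateAt h₁ w (const 0)
  h₂≗0 : ∀ v → h₂ v ≡ 0
  h₂≗0 v with v ≟ w | v ≟ u
  ... | yes refl | _ = updateAt-updates w h₁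
  ... | no v≢w | yes refl = trans (updateAt-minimal v w h₁ v≢w) (updateAt-updates u h)
  ... | no v≢w | no v≢u =
    trans (updateAt-minimal v w h₁ v≢w) (trans (updateAt-minimal v u h v≢u) (vanishes v v≢u v≢w))
  ∑h₂≡0 : ∑ h₂ ≡ 0
  ∑h₂≡0 = trans (sum-cong-≗ h₂≗0) (sum-replicate-zero n)

sum-map-≤-∑ : (h : Fin n → ℕ) {xs : List (Fin n)} → Unique xs → sum (map h xs) ≤ ∑ h
sum-map-≤-∑ h [] = z≤n
sum-map-≤-∑ {n} h {x ∷ xs} (x≢xs ∷ unique) = begin
  h x + sum (map h xs)   ≡⟨ cong (λ s → h x + sum s) (map-cong-local h≡h₁) ⟩
  h x + sum (map h₁ xs)  ≤⟨ +-monoʳ-≤ (h x) (sum-map-≤-∑ h₁ unique) ⟩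
  h x + ∑ h₁             ≡⟨ ∑-updateAt-0 h x ⟨
  ∑ h                    ∎
  where
  open ≤-Reasoning
  h₁ : Fin n → ℕ
  h₁ = updateAt h x (const 0)
  h≡h₁ : All (λ y → h y ≡ h₁ y) xs
  h≡h₁ = All.map (λ x≢y → sym (updateAt-minimal _ x h (≢-sym x≢y))) x≢xs

𝟙 : Bool → ℕ
𝟙 b = if b then 1 else 0

count : (Fin n → Bool) → ℕ
count p = ∑ (𝟙 ∘ p)

count-+-count-not : (p : Fin n → Bool) → count p + count (not ∘ p) ≡ n
count-+-count-not {n} p = begin
  count p + count (not ∘ p)           ≡⟨ ∑-distrib-+ (𝟙 ∘ p) (𝟙 ∘ not ∘ p) ⟨
  ∑ (λ i → 𝟙 (p i) + 𝟙 (not (p i)))   ≡⟨ sum-cong-≗ (λ i → 𝟙+𝟙-not (p i)) ⟩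
  ∑ {n} (const 1)                     ≡⟨ ∑-1 ⟩
  n                                   ∎
  where
  open ≡-Reasoning
  𝟙+𝟙-not : ∀ b → 𝟙 b + 𝟙 (not b) ≡ 1
  𝟙+𝟙-not true = refl
  𝟙+𝟙-not false = refl

count>0⇒∃ : (p : Fin n → Bool) → 0 < count p → ∃ λ i → p i ≡ true
count>0⇒∃ {suc n} p 0<count with p zero in p₀
... | true = zero , p₀
... | false = Prod.map suc id (count>0⇒∃ (p ∘ suc) 0<count)

count-outside : (p : Fin n → Bool) (xs : List (Fin n)) → length xs < count p →
                ∃ λ i → p i ≡ true × i ∉ xs
count-outside p [] 0<count = Prod.map₂ (_, λ ()) (count>0⇒∃ p 0<count)
count-outside {n} p (x ∷ xs) xs<count with count-outside p₁ xs xs<count₁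
  where
  p₁ : Fin n → Bool
  p₁ = updateAt p x (const false)
  count≡ : count p ≡ 𝟙 (p x) + count p₁
  count≡ = trans (∑-updateAt-0 (𝟙 ∘ p) x) (cong (𝟙 (p x) +_) (sym (sum-cong-≗
             (map-updateAt {f = 𝟙} {g = const false} {h = const 0} (λ _ → refl) p x))))
  𝟙≤1 : ∀ b → 𝟙 b ≤ 1
  𝟙≤1 true = s≤s z≤n
  𝟙≤1 false = z≤n
  xs<count₁ : length xs < count p₁
  xs<count₁ = s≤s⁻¹ (≤-trans xs<count (≤-trans (≤-reflexive count≡) (+-monoˡ-≤ _ (𝟙≤1 (p x)))))
... | i , p₁i , i∉xs = i , trans (sym (updateAt-minimal i x p i≢x)) p₁i , λ
  { (here i≡x) → i≢x i≡x ; (there i∈xs) → i∉xs i∈xs }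
  where
  i≢x : i ≢ x
  i≢x refl with trans (sym (updateAt-updates i p)) p₁i
  ... | ()

length≤count : (p : Fin n → Bool) {xs : List (Fin n)} → Unique xs →
               All (λ x → p x ≡ true) xs → length xs ≤ count p
length≤count p unique all = subst (_≤ count p) (sum≡length all) (sum-map-≤-∑ (𝟙 ∘ p) unique)
  where
  sum≡length : ∀ {xs} → All (λ x → p x ≡ true) xs → sum (map (𝟙 ∘ p) xs) ≡ length xs
  sum≡length [] = refl
  sum≡length (px ∷ all) = cong₂ _+_ (cong 𝟙 px) (sum≡length all)

count≡3-third : (p : Fin n → Bool) → count p ≡ 3 → ∀ {x y} → p x ≡ true → p y ≡ true → x ≢ y →
  ∃ λ z → p z ≡ true × z ≢ x × z ≢ y × (∀ w → w ≢ x → w ≢ y → w ≢ z → p w ≡ false)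
count≡3-third p count≡3 {x} {y} px py x≢y
  with count-outside p (x ∷ y ∷ []) (≤-reflexive (sym count≡3))
... | z , pz , z∉xy = z , pz , z≢x , z≢y , onlyThree
  where
  z≢x : z ≢ x
  z≢x = z∉xy ∘ here
  z≢y : z ≢ y
  z≢y = z∉xy ∘ there ∘ here
  onlyThree : ∀ w → w ≢ x → w ≢ y → w ≢ z → p w ≡ false
  onlyThree w w≢x w≢y w≢z with p w in pw
  ... | false = refl
  ... | true = contradiction
    (length≤count p ((x≢y ∷ ≢-sym z≢x ∷ ≢-sym w≢x ∷ []) ∷ (≢-sym z≢y ∷ ≢-sym w≢y ∷ []) ∷
                     (≢-sym w≢z ∷ []) ∷ [] ∷ [])
                    (px ∷ py ∷ pz ∷ pw ∷ []))
    (<-irrefl (sym count≡3))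

_⊆_ : Graph n → Graph n → Set
G ⊆ H = ∀ {i j} → G i j ≡ true → H i j ≡ true

NoUniversalVertex : Graph n → Set
NoUniversalVertex {n} G = ∀ (v : Fin n) → ∃ λ x → x ≢ v × G v x ≡ false

record DominatingEdge (G : Graph n) : Set where
  field
    u w         : Fin n
    u≢w         : u ≢ w
    adjacent-uw : G u w ≡ true
    adjacent-wu : G w u ≡ true
    dominates   : ∀ v → v ≢ u → v ≢ w → G v u ≡ true ⊎ G v w ≡ true

neighbour≢nonNeighbour : (G : Graph n) {v x y : Fin n} → G v x ≡ true → G v y ≡ false → x ≢ y
neighbour≢nonNeighbour G Gvx Gvy refl with trans (sym Gvx) Gvy
... | ()

addEdge-⊇ : (G : Graph n) {p q : Fin n} → G ⊆ addEdge G p q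
addEdge-⊇ G Gij rewrite Gij = refl

addEdge-nonEdge : (G : Graph n) {p q v x : Fin n} → G v x ≡ false →
                  ¬ (v ≡ p × x ≡ q) → ¬ (v ≡ q × x ≡ p) → addEdge G p q v x ≡ false
addEdge-nonEdge G {p} {q} {v} {x} Gvx ¬pq ¬qp rewrite Gvx =
  cong₂ _∨_ (both-false (v ≟ p) (x ≟ q) ¬pq) (both-false (v ≟ q) (x ≟ p) ¬qp)
  where
  both-false : ∀ {A B : Set} (a? : Dec A) (b? : Dec B) → ¬ (A × B) → ⌊ a? ⌋ ∧ ⌊ b? ⌋ ≡ false
  both-false a? b? ¬ab = trans (cong₂ _∧_ (isYes≗does a?) (isYes≗does b?)) (dec-false (a? ×-dec b?) ¬ab)

addEdge-simple : {G : Graph n} {p q : Fin n} → p ≢ q → IsSimple G → IsSimple (addEdge G p q)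
addEdge-simple {G = G} {p} {q} p≢q (loopless , symmetric) = loopless′ , symmetric′
  where
  loopless′ : ∀ v → addEdge G p q v v ≡ false
  loopless′ v = addEdge-nonEdge G (loopless v)
    (λ (v≡p , v≡q) → p≢q (trans (sym v≡p) v≡q)) (λ (v≡q , v≡p) → p≢q (trans (sym v≡p) v≡q))
  symmetric′ : ∀ i j → addEdge G p q i j ≡ addEdge G p q j i
  symmetric′ i j = cong₂ _∨_ (symmetric i j)
    (trans (cong₂ _∨_ (∧-comm ⌊ i ≟ p ⌋ ⌊ j ≟ q ⌋) (∧-comm ⌊ i ≟ q ⌋ ⌊ j ≟ p ⌋))
           (∨-comm (⌊ j ≟ q ⌋ ∧ ⌊ i ≟ p ⌋) (⌊ j ≟ p ⌋ ∧ ⌊ i ≟ q ⌋)))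

addEdge-keepsNonNeighbour : (G : Graph n) {p q v a b : Fin n} → a ≢ b → a ≢ v → b ≢ v →
  G v a ≡ false → G v b ≡ false → ∃ λ x → x ≢ v × addEdge G p q v x ≡ false
addEdge-keepsNonNeighbour G {p} {q} {v} {a} {b} a≢b a≢v b≢v Gva Gvb
  with (v ≟ p ×-dec a ≟ q) ⊎-dec (v ≟ q ×-dec a ≟ p)
... | no ¬new = a , a≢v , addEdge-nonEdge G Gva (¬new ∘ inj₁) (¬new ∘ inj₂)
... | yes (inj₁ (_ , a≡q)) = b , b≢v , addEdge-nonEdge G Gvb
  (λ (_ , b≡q) → a≢b (trans a≡q (sym b≡q))) (λ (v≡q , _) → a≢v (trans a≡q (sym v≡q)))
... | yes (inj₂ (_ , a≡p)) = b , b≢v , addEdge-nonEdge G Gvb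
  (λ (v≡p , _) → a≢v (trans a≡p (sym v≡p))) (λ (_ , b≡p) → a≢b (trans a≡p (sym b≡p)))

dominates-via-nonNeighbours : {G : Graph n} → (∀ i j → G i j ≡ G j i) → {u a b w : Fin n} →
  (∀ x → x ≢ u → x ≢ a → x ≢ b → G u x ≡ true) → G a w ≡ true → G b w ≡ true →
  ∀ v → v ≢ u → G v u ≡ true ⊎ G v w ≡ true
dominates-via-nonNeighbours {G = G} symmetric {u} {a} {b} adjacent-u Gaw Gbw v v≢u with v ≟ a | v ≟ b
... | yes refl | _ = inj₂ Gaw
... | no _ | yes refl = inj₂ Gbw
... | no v≢a | no v≢b = inj₁ (trans (symmetric v u) (adjacent-u v v≢u v≢a v≢b))

isTRDF-⊆ : {G H : Graph n} {f : Fin n → Fin 3} → G ⊆ H → IsTRDF G f → IsTRDF H f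
isTRDF-⊆ G⊆H (dominated , total) =
  (λ v fv≡0 → Prod.map₂ (Prod.map₁ G⊆H) (dominated v fv≡0)) ,
  (λ v 0<fv → Prod.map₂ (Prod.map₁ G⊆H) (total v 0<fv))

weight-≥ : (f : Fin n → Fin 3) {xs : List (Fin n)} → Unique xs → sum (map (val f) xs) ≤ weight f
weight-≥ f {xs} unique =
  subst (sum (map (val f) xs) ≤_) (sym (sum-map-allFin (val f))) (sum-map-≤-∑ (val f) unique)

noUniversal⇒weight≥4 : {G : Graph n} → 4 ≤ n → IsSimple G → NoUniversalVertex G →
                       ∀ f → IsTRDF G f → 4 ≤ weight f
noUniversal⇒weight≥4 {n} {G} 4≤n (loopless , symmetric) nonAdjacent f (dominated , total)
  with any? (λ v → val f v ℕ.≟ 2)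
... | no no2 = begin
  4                ≤⟨ 4≤n ⟩
  n                ≡⟨ ∑-1 ⟨
  ∑ {n} (const 1)  ≤⟨ ∑-mono-≤ positive ⟩
  ∑ (val f)        ≡⟨ sum-map-allFin (val f) ⟨
  weight f         ∎
  where
  open ≤-Reasoning
  positive : ∀ v → 1 ≤ val f v
  positive v with val f v ℕ.≟ 0
  ... | yes fv≡0 = contradiction (Prod.map₂ Prod.proj₂ (dominated v fv≡0)) no2
  ... | no fv≢0 = n≢0⇒n>0 fv≢0
... | yes (v , fv≡2) with nonAdjacent v
... | x , x≢v , Gvx with val f x ℕ.≟ 0
... | yes fx≡0 =
  let (u , Gxu , fu≡2) = dominated x fx≡0
      u≢v : u ≢ v
      u≢v = neighbour≢nonNeighbour G Gxu (trans (symmetric x v) Gvx)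
  in begin
  4                         ≡⟨ cong₂ (λ a b → a + (b + 0)) fv≡2 fu≡2 ⟨
  val f v + (val f u + 0)   ≤⟨ weight-≥ f ((≢-sym u≢v ∷ []) ∷ [] ∷ []) ⟩
  weight f                  ∎
  where open ≤-Reasoning
... | no fx≢0 =
  let (y , Gvy , 0<fy) = total v (subst (0 <_) (sym fv≡2) (s≤s z≤n))
      y≢v : y ≢ v
      y≢v = neighbour≢nonNeighbour G Gvy (loopless v)
      y≢x : y ≢ x
      y≢x = neighbour≢nonNeighbour G Gvy Gvx
  in begin
  4                                     ≤⟨ +-mono-≤ (≤-reflexive (sym fv≡2))
                                             (+-mono-≤ (n≢0⇒n>0 fx≢0) (+-mono-≤ 0<fy z≤n)) ⟩
  val f v + (val f x + (val f y + 0))   ≤⟨ weight-≥ f ((≢-sym x≢v ∷ ≢-sym y≢v ∷ []) ∷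
                                                        (≢-sym y≢x ∷ []) ∷ [] ∷ []) ⟩
  weight f                              ∎
  where open ≤-Reasoning

pairLabel : Fin n → Fin n → Fin n → Fin 3
pairLabel u w v = if ⌊ v ≟ u ⌋ ∨ ⌊ v ≟ w ⌋ then # 2 else # 0

pairLabel-on : {u w v : Fin n} → v ≡ u ⊎ v ≡ w → val (pairLabel u w) v ≡ 2
pairLabel-on {u = u} {w} {v} v∈uw with v ≟ u | v ≟ w
... | yes _ | _ = refl
... | no _ | yes _ = refl
... | no v≢u | no v≢w = ⊥-elim ([ v≢u , v≢w ]′ v∈uw)

pairLabel-off : {u w v : Fin n} → v ≢ u → v ≢ w → val (pairLabel u w) v ≡ 0
pairLabel-off {u = u} {w} {v} v≢u v≢w with v ≟ u | v ≟ w
... | yes v≡u | _ = contradiction v≡u v≢u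
... | no _ | yes v≡w = contradiction v≡w v≢w
... | no _ | no _ = refl

pairLabel-support : {u w v : Fin n} → 0 < val (pairLabel u w) v → v ≡ u ⊎ v ≡ w
pairLabel-support {u = u} {w} {v} 0<fv with v ≟ u | v ≟ w
... | yes v≡u | _ = inj₁ v≡u
... | no _ | yes v≡w = inj₂ v≡w
... | no _ | no _ = contradiction 0<fv λ ()

dominatingEdge⇒TRDF : {G : Graph n} → DominatingEdge G → ∃ λ f → IsTRDF G f × weight f ≡ 4
dominatingEdge⇒TRDF {n} {G} e = f , (dominated , total) , weight≡4
  where
  open DominatingEdge e
  f : Fin n → Fin 3
  f = pairLabel u w
  fu≡2 : val f u ≡ 2
  fu≡2 = pairLabel-on {u = u} {w} (inj₁ refl)
  fw≡2 : val f w ≡ 2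
  fw≡2 = pairLabel-on {u = u} {w} (inj₂ refl)
  dominated : ∀ v → val f v ≡ 0 → ∃ λ x → G v x ≡ true × val f x ≡ 2
  dominated v fv≡0 =
    [ (λ Gvu → u , Gvu , fu≡2) , (λ Gvw → w , Gvw , fw≡2) ]′ (dominates v v≢u v≢w)
    where
    v≢u : v ≢ u
    v≢u refl = contradiction (trans (sym fu≡2) fv≡0) λ ()
    v≢w : v ≢ w
    v≢w refl = contradiction (trans (sym fw≡2) fv≡0) λ ()
  total : ∀ v → 0 < val f v → ∃ λ x → G v x ≡ true × 0 < val f x
  total v 0<fv with pairLabel-support {u = u} {w} {v} 0<fv
  ... | inj₁ refl = w , adjacent-uw , subst (0 <_) (sym fw≡2) (s≤s z≤n)
  ... | inj₂ refl = u , adjacent-wu , subst (0 <_) (sym fu≡2) (s≤s z≤n)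
  weight≡4 : weight f ≡ 4
  weight≡4 = trans (sum-map-allFin (val f))
                   (trans (∑-pair (val f) u≢w (λ v → pairLabel-off))
                          (cong₂ _+_ fu≡2 fw≡2))

module _ {n} {G : Graph n} (simple : IsSimple G) (regular : IsRegular G (n ∸ 3)) (3≤n : 3 ≤ n) where

  private
    loopless : ∀ v → G v v ≡ false
    loopless = Prod.proj₁ simple
    symmetric : ∀ i j → G i j ≡ G j i
    symmetric = Prod.proj₂ simple

  count-adjacent : ∀ v → count (G v) ≡ n ∸ 3
  count-adjacent v = trans (sym (sum-map-allFin (𝟙 ∘ G v))) (regular v)

  count-nonAdjacent : ∀ v → count (not ∘ G v) ≡ 3
  count-nonAdjacent v = +-cancelˡ-≡ (n ∸ 3) _ _ (begin
    n ∸ 3 + count (not ∘ G v)        ≡⟨ cong (_+ count (not ∘ G v)) (count-adjacent v) ⟨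
    count (G v) + count (not ∘ G v)  ≡⟨ count-+-count-not (G v) ⟩
    n                                ≡⟨ m∸n+n≡m 3≤n ⟨
    n ∸ 3 + 3                        ∎)
    where open ≡-Reasoning

  someNonNeighbour : NoUniversalVertex G
  someNonNeighbour v =
    let (a , ¬Gva , a∉v) = count-outside (not ∘ G v) (v ∷ [])
                             (subst (1 <_) (sym (count-nonAdjacent v)) (s≤s (s≤s z≤n)))
    in a , a∉v ∘ here , not-injective ¬Gva

  otherNonNeighbour : ∀ {v a} → a ≢ v → G v a ≡ false →
    ∃ λ b → b ≢ v × b ≢ a × G v b ≡ false × (∀ x → x ≢ v → x ≢ a → x ≢ b → G v x ≡ true)
  otherNonNeighbour {v} a≢v Gva =
    let (b , ¬Gvb , b≢v , b≢a , rest) =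
          count≡3-third (not ∘ G v) (count-nonAdjacent v)
                        (cong not (loopless v)) (cong not Gva) (≢-sym a≢v)
    in b , b≢v , b≢a , not-injective ¬Gvb , λ x x≢v x≢a x≢b → not-injective (rest x x≢v x≢a x≢b)

  addEdge-noUniversal : ∀ p q → NoUniversalVertex (addEdge G p q)
  addEdge-noUniversal p q v =
    let (a , a≢v , Gva) = someNonNeighbour v
        (b , b≢v , b≢a , Gvb , _) = otherNonNeighbour a≢v Gva
    in addEdge-keepsNonNeighbour G {p} {q} (≢-sym b≢a) a≢v b≢v Gva Gvb

  -- With non-neighbourhoods {u, a, b}, {a, u, a′} and {b, u, b′}, any neighbour w of u outside
  -- {a′, b′} is adjacent to a and b; it exists since u has n − 3 > 2 neighbours.
  dominatingEdge : 6 ≤ n → Fin n → DominatingEdge G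
  dominatingEdge 6≤n u =
    let (a , a≢u , Gua) = someNonNeighbour u
        (b , b≢u , _ , Gub , adjacent-u) = otherNonNeighbour a≢u Gua
        (a′ , _ , _ , _ , adjacent-a) = otherNonNeighbour (≢-sym a≢u) (trans (symmetric a u) Gua)
        (b′ , _ , _ , _ , adjacent-b) = otherNonNeighbour (≢-sym b≢u) (trans (symmetric b u) Gub)
        (w , Guw , w∉a′b′) = count-outside (G u) (a′ ∷ b′ ∷ [])
                               (subst (2 <_) (sym (count-adjacent u)) (∸-monoˡ-≤ 3 6≤n))
        w≢u : w ≢ u
        w≢u = neighbour≢nonNeighbour G Guw (loopless u)
        Gaw : G a w ≡ true
        Gaw = adjacent-a w (neighbour≢nonNeighbour G Guw Gua) w≢u (w∉a′b′ ∘ here)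
        Gbw : G b w ≡ true
        Gbw = adjacent-b w (neighbour≢nonNeighbour G Guw Gub) w≢u (w∉a′b′ ∘ there ∘ here)
    in record
      { u = u ; w = w ; u≢w = ≢-sym w≢u ; adjacent-uw = Guw
      ; adjacent-wu = trans (symmetric w u) Guw
      ; dominates = λ v v≢u _ → dominates-via-nonNeighbours symmetric adjacent-u Gaw Gbw v v≢u }

mainTheorem8 : ∀ (n : ℕ) (G : Graph n) → 6 ≤ n → IsSimple G → IsRegular G (n ∸ 3) →
    IsTRDomNumber G 4 ×
    (∀ (u v : Fin n) → IsNonEdge G u v → IsTRDomNumber (addEdge G u v) 4)
mainTheorem8 n G 6≤n simple regular =
  (edgeTRDF , noUniversal⇒weight≥4 4≤n simple (someNonNeighbour simple regular 3≤n)) ,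
  -- The argument only needs p ≢ q: adding an edge that is already present changes nothing.
  λ p q (p≢q , _) →
    Prod.map₂ (Prod.map₁ (isTRDF-⊆ (addEdge-⊇ G))) edgeTRDF ,
    noUniversal⇒weight≥4 4≤n (addEdge-simple p≢q simple) (addEdge-noUniversal simple regular 3≤n p q)
  where
  3≤n : 3 ≤ n
  3≤n = ≤-trans (m≤m+n 3 3) 6≤n
  4≤n : 4 ≤ n
  4≤n = ≤-trans (m≤m+n 4 2) 6≤n
  someVertex : Fin n
  someVertex = fromℕ< {0} (≤-trans (s≤s z≤n) 6≤n)
  edgeTRDF : ∃ λ f → IsTRDF G f × weight f ≡ 4
  edgeTRDF = dominatingEdge⇒TRDF (dominatingEdge simple regular 3≤n 6≤n someVertex)
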